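{- For every $\lambda Q$-term $M$, $M\twoheadrightarrow_{\pi}M^{\triangledown}$, i.e. $M$ reduces to $M^{\triangledown}$ in zero or more steps of the rules $\pi_1,\pi_2$ (applied in any subterm position).
   Context: $\lambda Q$: terms $M,N::=\uparrow V\mid x(V,y.N)\mid\mathsf{C}(M,x.N)$; values $V,W::=x\mid\lambda x.M$ (in $y(V,z.N)$ and $x.N$ the variable before the dot is bound in the following term); terms up to $\alpha$-equivalence. Rules $(\pi_1)$ $\mathsf{C}(z(V,y.P),x.N)\to z(V,y.\mathsf{C}(P,x.N))$ and $(\pi_2)$ $\mathsf{C}(\mathsf{C}(M,y.P),x.N)\to\mathsf{C}(M,y.\mathsf{C}(P,x.N))$. LNF-terms are the $\lambda Q$-terms in which every cut has the form $\mathsf{C}(\uparrow V,x.N)$, written $\mathsf{C}_v(V,x.N)$. Derived cut on LNF-terms: $\mathsf{C}_v(\uparrow V:z.N)=\mathsf{C}_v(V,z.N)$; $\mathsf{C}_v(x(V,y.M):z.N)=x(V,y.\mathsf{C}_v(M:z.N))$; $\mathsf{C}_v(\mathsf{C}_v(V,y.M):z.N)=\mathsf{C}_v(V,y.\mathsf{C}_v(M:z.N))$. Map $(\cdot)^{\triangledown}$: $(\uparrow V)^{\triangledown}=\uparrow V^{\triangledown\triangledown}$; $(x(V,y.N))^{\triangledown}=x(V^{\triangledown\triangledown},y.N^{\triangledown})$; $(\mathsf{C}(M,y.N))^{\triangledown}=\mathsf{C}_v(M^{\triangledown}:y.N^{\triangledown})$; $x^{\triangledown\triangledown}=x$; $(\lambda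 x.M)^{\triangledown\triangledown}=\lambda x.M^{\triangledown}$. -}

module Defs where

open import Data.Nat using (ℕ; zero; suc)
open import Data.Fin using (Fin; zero; suc)
open import Relation.Binary.Construct.Closure.ReflexiveTransitive using (Star)

-- Well-scoped λQ-terms with de Bruijn indices (α-equivalence is syntactic identity).
-- Tm n / Val n : terms / values with n free variables.
mutual
  data Tm (n : ℕ) : Set where
    ↑_   : Val n → Tm n
    -- x(V, y.N): x a variable, y bound in N
    app  : Fin n → Val n → Tm (suc n) → Tm n
    -- C(M, x.N): x bound in N
    cut  : Tm n → Tm (suc n) → Tm n

  data Val (n : ℕ) : Set where
    var : Fin n → Val n
    lam : Tm (suc n) → Val n

Ren : ℕ → ℕ → Set
Ren n m = Fin n → Fin m

ext : ∀ {n m} → Ren n m → Ren (suc n) (suc m)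
ext ρ zero    = zero
ext ρ (suc i) = suc (ρ i)

mutual
  renT : ∀ {n m} → Ren n m → Tm n → Tm m
  renT ρ (↑ V)       = ↑ renV ρ V
  renT ρ (app x V N) = app (ρ x) (renV ρ V) (renT (ext ρ) N)
  renT ρ (cut M N)   = cut (renT ρ M) (renT (ext ρ) N)

  renV : ∀ {n m} → Ren n m → Val n → Val m
  renV ρ (var x) = var (ρ x)
  renV ρ (lam M) = lam (renT (ext ρ) M)

-- weaken a term living under binder x (index 0) by a new binder y inserted
-- just outside x: used when x.N is moved under the binder y.
wk1 : ∀ {n} → Tm (suc n) → Tm (suc (suc n))
wk1 = renT (ext suc)

mutual
  infix 4 _→π_ _→πv_
  data _→π_ {n : ℕ} : Tm n → Tm n → Set where
    π₁ : ∀ z V P N → cut (app z V P) N →π app z V (cut P (wk1 N))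
    π₂ : ∀ M P N → cut (cut M P) N →π cut M (cut P (wk1 N))
    ξ-↑    : ∀ {V V'} → V →πv V' → ↑ V →π ↑ V'
    ξ-appV : ∀ {x V V' N} → V →πv V' → app x V N →π app x V' N
    ξ-appN : ∀ {x V N N'} → N →π N' → app x V N →π app x V N'
    ξ-cutM : ∀ {M M' N} → M →π M' → cut M N →π cut M' N
    ξ-cutN : ∀ {M N N'} → N →π N' → cut M N →π cut M N'

  data _→πv_ {n : ℕ} : Val n → Val n → Set where
    ξ-lam : ∀ {M M'} → M →π M' → lam M →πv lam M'

_↠π_ : ∀ {n} → Tm n → Tm n → Set
_↠π_ = Star _→π_

-- Derived cut on LNF-terms: C_v(M : z.N) (C_v(V,x.N) is cut (↑ V) N)
cutv : ∀ {n} → Tm n → Tm (suc n) → Tm n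
cutv (↑ V)              N = cut (↑ V) N
cutv (app x V M)        N = app x V (cutv M (wk1 N))
cutv (cut (↑ V) M)      N = cut (↑ V) (cutv M (wk1 N))
-- the remaining cases do not arise on LNF-terms (the derived cut is only
-- defined there); they are filled with an arbitrary value (the plain cut)
-- and are never reached by ▽, whose output is always an LNF-term
cutv (cut (app x V P) M) N = cut (cut (app x V P) M) N
cutv (cut (cut L P) M)   N = cut (cut (cut L P) M) N

mutual
  ▽ : ∀ {n} → Tm n → Tm n
  ▽ (↑ V)       = ↑ ▽▽ V
  ▽ (app x V N) = app x (▽▽ V) (▽ N)
  ▽ (cut M N)   = cutv (▽ M) (▽ N)

  ▽▽ : ∀ {n} → Val n → Val n
  ▽▽ (var x) = var x
  ▽▽ (lam M) = lam (▽ M)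

module Submission where

-- C(M, z.N) π-reduces to the derived cut C_v(M : z.N): on an LNF-term M each clause of
-- the derived cut is one π₁ or π₂ step followed by the same situation one binder deeper.
-- Hence reducing bottom-up, first the immediate subterms to their ▽-images and then the
-- cut itself, takes every term to its ▽-image.

open import Data.Nat using (ℕ; suc)
open import Data.Fin using (Fin)
open import Relation.Binary.Construct.Closure.ReflexiveTransitive using (Star; ε; _◅_; _◅◅_; gmap)
open import Defs

_↠πv_ : ∀ {n} → Val n → Val n → Set
_↠πv_ = Star _→πv_

variable
  n : ℕ
  V V′ : Val n
  M M′ : Tm n

↑-↠π : V ↠πv V′ → (↑ V) ↠π (↑ V′)
↑-↠π = gmap ↑_ ξ-↑

app-↠π : ∀ {x : Fin n} {V V′ N N′} → V ↠πv V′ → N ↠π N′ → app x V N ↠π app x V′ N′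
app-↠π {x = x} {V′ = V′} {N = N} V↠V′ N↠N′ =
  gmap (λ W → app x W N) ξ-appV V↠V′ ◅◅ gmap (app x V′) ξ-appN N↠N′

cut-↠π : ∀ {M M′ : Tm n} {N N′} → M ↠π M′ → N ↠π N′ → cut M N ↠π cut M′ N′
cut-↠π {M′ = M′} {N = N} M↠M′ N↠N′ =
  gmap (λ L → cut L N) ξ-cutM M↠M′ ◅◅ gmap (cut M′) ξ-cutN N↠N′

lam-↠πv : M ↠π M′ → lam M ↠πv lam M′
lam-↠πv = gmap lam ξ-lam

cut↠πcutv : (M : Tm n) (N : Tm (suc n)) → cut M N ↠π cutv M N
cut↠πcutv (↑ V)               N = ε
cut↠πcutv (app x V M)         N = π₁ x V M N ◅ app-↠π ε (cut↠πcutv M (wk1 N))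
cut↠πcutv (cut (↑ V) M)       N = π₂ (↑ V) M N ◅ cut-↠π ε (cut↠πcutv M (wk1 N))
cut↠πcutv (cut (app _ _ _) _) N = ε
cut↠πcutv (cut (cut _ _) _)   N = ε

mutual
  ↠π▽ : (M : Tm n) → M ↠π ▽ M
  ↠π▽ (↑ V)       = ↑-↠π (↠πv▽▽ V)
  ↠π▽ (app x V N) = app-↠π (↠πv▽▽ V) (↠π▽ N)
  ↠π▽ (cut M N)   = cut-↠π (↠π▽ M) (↠π▽ N) ◅◅ cut↠πcutv (▽ M) (▽ N)

  ↠πv▽▽ : (V : Val n) → V ↠πv ▽▽ V
  ↠πv▽▽ (var x) = ε
  ↠πv▽▽ (lam M) = lam-↠πv (↠π▽ M)

corollary5 : ∀ {n} (M : Tm n) → M ↠π ▽ M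
corollary5 = ↠π▽
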